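{- For all lists of integers $c_1,c_2$ with $\mathit{Wf}\ c_1$ and $\mathit{Wf}\ c_2$, and for all integers $\ell_1,\ell_2$: if $\ell_1\in c_1$, $\ell_2\in c_2$ and $\ell_1=\ell_2$, then $\ell_1\in c_1\bowtie c_2$ and $\mathit{count}(\ell_1, c_1\bowtie c_2)=1$.
   Context: Literals are integers and clauses are finite lists of integers. Lists are written $x::xs$ (cons) and $\mathit{nil}$ (empty); $\mathit{rev}$ reverses a list, $\mathit{app}$ concatenates two lists, $\mathit{abs}$ is the absolute value, $\in$ denotes list membership, and $\mathit{count}(\ell,c)$ is the number of occurrences of $\ell$ in the list $c$. The function $\mathit{auxunion}(c_1,c_2,acc)$ is defined recursively by: - if $c_1=\mathit{nil}$, return $\mathit{app}(\mathit{rev}\ acc,c_2)$; - else if $c_2=\mathit{nil}$, return $\mathit{app}(\mathit{rev}\ acc,c_1)$; - else, with $c_1=x::xs$ and $c_2=y::ys$: - if $\mathit{abs}\,x<\mathit{abs}\,y$, return $\mathit{auxunion}(xs,y::ys,x::acc)$; - else if $\mathit{abs}\,y<\mathit{abs}\,x$, return $\mathit{auxunion}(x::xs,ys,y::acc)$; - else if $x=y$, return $\mathit{auxunion}(xs,ys,x::acc)$; - else return $\mathit{auxunion}(xs,ys,x::y::acc)$. The function $\mathit{union}(c_1,c_2,acc)$ is defined recursively by: - if $c_1=\mathit{nil}$, return $\mathit{app}(\mathit{rev}\ acc,c_2)$; - else if $c_2=\mathit{nil}$, return $\mathit{app}(\mathit{rev}\ acc,c_1)$; - else, with $c_1=x::xs$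 and $c_2=y::ys$: - if $x+y=0$, return $\mathit{auxunion}(xs,ys,acc)$; - else if $\mathit{abs}\,x<\mathit{abs}\,y$, return $\mathit{union}(xs,y::ys,x::acc)$; - else if $\mathit{abs}\,y<\mathit{abs}\,x$, return $\mathit{union}(x::xs,ys,y::acc)$; - else return $\mathit{union}(xs,ys,x::acc)$. The resolution function is $c_1\bowtie c_2:=\mathit{union}(c_1,c_2,\mathit{nil})$. $\mathit{Wf}\ c$ means the conjunction of three conditions: - $\mathit{NoCompPair}\ c$: there is no literal $x\in c$ with $-x\in c$; - $\mathit{NoDup}\ c$: $c$ has no duplicate elements; - $\mathit{sorted}\ c$: $c$ is sorted in ascending order of absolute value. -}

module Defs where

open import Data.Integer using (ℤ; _+_; -_; ∣_∣; _≟_; 0ℤ)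
open import Data.Nat as ℕ using (ℕ; _<?_; _≤_)
open import Data.List using (List; []; _∷_; reverse; _++_; length; filter)
open import Data.List.Membership.Propositional using (_∈_)
open import Data.List.Relation.Unary.Unique.Propositional using (Unique)
open import Data.List.Relation.Unary.Linked using (Linked)
open import Data.Product using (_×_)
open import Relation.Nullary using (¬_; yes; no)
open import Relation.Nullary.Decidable using (⌊_⌋)
open import Data.Bool using (if_then_else_)

-- auxunion c1 c2 acc  (decisions via boolean tests so that the
-- lexicographic termination on (c1, c2) is visible to Agda)
auxunion : List ℤ → List ℤ → List ℤ → List ℤ
auxunion [] c₂ acc = reverse acc ++ c₂
auxunion (x ∷ xs) [] acc = reverse acc ++ (x ∷ xs)
auxunion (x ∷ xs) (y ∷ ys) acc =
  if ⌊ ∣ x ∣ <? ∣ y ∣ ⌋ then auxunion xs (y ∷ ys) (x ∷ acc)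
  else if ⌊ ∣ y ∣ <? ∣ x ∣ ⌋ then auxunion (x ∷ xs) ys (y ∷ acc)
  else if ⌊ x ≟ y ⌋ then auxunion xs ys (x ∷ acc)
  else auxunion xs ys (x ∷ y ∷ acc)

union : List ℤ → List ℤ → List ℤ → List ℤ
union [] c₂ acc = reverse acc ++ c₂
union (x ∷ xs) [] acc = reverse acc ++ (x ∷ xs)
union (x ∷ xs) (y ∷ ys) acc =
  if ⌊ x + y ≟ 0ℤ ⌋ then auxunion xs ys acc
  else if ⌊ ∣ x ∣ <? ∣ y ∣ ⌋ then union xs (y ∷ ys) (x ∷ acc)
  else if ⌊ ∣ y ∣ <? ∣ x ∣ ⌋ then union (x ∷ xs) ys (y ∷ acc)
  else union xs ys (x ∷ acc)

_⋈_ : List ℤ → List ℤ → List ℤ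
c₁ ⋈ c₂ = union c₁ c₂ []

count : ℤ → List ℤ → ℕ
count ℓ c = length (filter (_≟ ℓ) c)

NoCompPair : List ℤ → Set
NoCompPair c = ∀ x → x ∈ c → ¬ (- x ∈ c)

NoDup : List ℤ → Set
NoDup c = Unique c

sorted : List ℤ → Set
sorted c = Linked (λ x y → ∣ x ∣ ≤ ∣ y ∣) c

Wf : List ℤ → Set
Wf c = NoCompPair c × NoDup c × sorted c

-- Both merges walk the clauses in order of absolute value and emit every literal they
-- consume, except that union drops one complementary pair x, -x and a literal heading both
-- clauses is emitted once. A literal ℓ common to both clauses is never dropped, as that would
-- put -ℓ into one of them; by sortedness it reaches the heads of both clauses simultaneously
-- and is emitted once, and by the absence of duplicates no further copy of it remains.
module Submission where

open import Defs
open import Algebra.Properties.AbelianGroup as Group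
open import Data.Integer using (ℤ; +_; -[1+_]; _+_; -_; ∣_∣; _≟_; 0ℤ)
open import Data.Integer.Properties using (+-0-abelianGroup; +-inverseʳ; neg-involutive)
open import Data.Nat as ℕ using (suc; _<?_)
open import Data.Nat.Properties using (≤-refl; ≤-trans; <-irrefl; <-≤-trans; ≮⇒≥; ≤∧≮⇒≡; +-identityʳ; suc-injective)
open import Data.List using (List; []; _∷_; reverse; _++_; length; filter)
open import Data.List.Properties using (filter-accept; filter-reject; filter-++; length-++)
open import Data.List.Membership.Propositional using (_∈_; _∉_)
open import Data.List.Relation.Binary.Permutation.Propositional using (_↭_)
open import Data.List.Relation.Binary.Permutation.Propositional.Properties using (↭-length; filter-↭; ↭-reverse; ++⁺ʳ)
open import Data.List.Relation.Unary.Any as Any using (here; there)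
open import Data.List.Relation.Unary.All as All using ()
open import Data.List.Relation.Unary.AllPairs using (_∷_)
open import Data.List.Relation.Unary.Linked as Linked using (_∷_)
open import Data.Product using (_×_; _,_)
open import Data.Empty using (⊥-elim)
open import Function using (_∘_)
open import Relation.Nullary using (Dec; yes; no; ¬_; ⌊_⌋)
open import Relation.Nullary.Decidable using (decidable-stable)
open import Data.Bool using (if_then_else_)
open import Relation.Binary.PropositionalEquality using (_≡_; _≢_; refl; sym; trans; cong)

count-∷-≡ : ∀ ℓ c → count ℓ (ℓ ∷ c) ≡ suc (count ℓ c)
count-∷-≡ ℓ c = cong length (filter-accept (_≟ ℓ) refl)

count-∷-≢ : ∀ {ℓ x} c → x ≢ ℓ → count ℓ (x ∷ c) ≡ count ℓ c
count-∷-≢ {ℓ} c x≢ℓ = cong length (filter-reject (_≟ ℓ) x≢ℓ)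

count-∉ : ∀ {ℓ} c → ℓ ∉ c → count ℓ c ≡ 0
count-∉ [] _ = refl
count-∉ {ℓ} (x ∷ c) ℓ∉ with x ≟ ℓ
... | yes refl = ⊥-elim (ℓ∉ (here refl))
... | no _ = count-∉ c (ℓ∉ ∘ there)

count-↭ : ∀ ℓ {c d} → c ↭ d → count ℓ c ≡ count ℓ d
count-↭ ℓ = ↭-length ∘ filter-↭ (_≟ ℓ)

count-++ : ∀ ℓ c d → count ℓ (c ++ d) ≡ count ℓ c ℕ.+ count ℓ d
count-++ ℓ c d = trans (cong length (filter-++ (_≟ ℓ) c d)) (length-++ (filter (_≟ ℓ) c))

count-reverse-++-∉ : ∀ {ℓ} acc c → ℓ ∉ c → count ℓ (reverse acc ++ c) ≡ count ℓ acc
count-reverse-++-∉ {ℓ} acc c ℓ∉c = trans (count-↭ ℓ (++⁺ʳ c (↭-reverse acc)))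
  (trans (count-++ ℓ acc c) (trans (cong (count ℓ acc ℕ.+_) (count-∉ c ℓ∉c)) (+-identityʳ _)))

count≡suc⇒∈ : ∀ {ℓ n} c → count ℓ c ≡ suc n → ℓ ∈ c
count≡suc⇒∈ {ℓ} (x ∷ c) eq with x ≟ ℓ
... | yes refl = here refl
... | no _ = there (count≡suc⇒∈ c eq)

∣i∣≡∣j∣∧i≢j⇒j≡-i : ∀ i j → ∣ i ∣ ≡ ∣ j ∣ → i ≢ j → j ≡ - i
∣i∣≡∣j∣∧i≢j⇒j≡-i (+ m) (+ n) eq i≢j = ⊥-elim (i≢j (cong +_ eq))
∣i∣≡∣j∣∧i≢j⇒j≡-i (+ _) -[1+ _ ] refl _ = refl
∣i∣≡∣j∣∧i≢j⇒j≡-i -[1+ _ ] (+ _) refl _ = refl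
∣i∣≡∣j∣∧i≢j⇒j≡-i -[1+ m ] -[1+ n ] eq i≢j = ⊥-elim (i≢j (cong -[1+_] (suc-injective eq)))

i≡-j⇒j≡-i : ∀ {i j} → i ≡ - j → j ≡ - i
i≡-j⇒j≡-i {j = j} refl = sym (neg-involutive j)

i+j≡0⇒j≡-i : ∀ i j → i + j ≡ 0ℤ → j ≡ - i
i+j≡0⇒j≡-i = Group.inverseʳ-unique +-0-abelianGroup

∣i∣≡∣j∣∧i+j≢0⇒i≡j : ∀ i j → ∣ i ∣ ≡ ∣ j ∣ → i + j ≢ 0ℤ → i ≡ j
∣i∣≡∣j∣∧i+j≢0⇒i≡j i j eq i+j≢0 = decidable-stable (i ≟ j) λ i≢j →
  i+j≢0 (trans (cong (_+_ i) (∣i∣≡∣j∣∧i≢j⇒j≡-i i j eq i≢j)) (+-inverseʳ i))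

WfMember : ℤ → List ℤ → Set
WfMember ℓ c = Wf c × ℓ ∈ c

WfMember-tail : ∀ {ℓ x xs} → x ≢ ℓ → WfMember ℓ (x ∷ xs) → WfMember ℓ xs
WfMember-tail x≢ℓ ((ncp , _ ∷ nd , srt) , ℓ∈) =
  ((λ z z∈ -z∈ → ncp z (there z∈) (there -z∈)) , nd , Linked.tail srt) , Any.tail (x≢ℓ ∘ sym) ℓ∈

WfMember-head∉tail : ∀ {ℓ xs} → WfMember ℓ (ℓ ∷ xs) → ℓ ∉ xs
WfMember-head∉tail ((_ , ℓ∉ ∷ _ , _) , _) ℓ∈ = All.lookup ℓ∉ ℓ∈ refl

WfMember-head≤ : ∀ {ℓ y ys} → WfMember ℓ (y ∷ ys) → ∣ y ∣ ℕ.≤ ∣ ℓ ∣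
WfMember-head≤ ((_ , _ , srt) , ℓ∈) = go srt ℓ∈
  where
  go : ∀ {ℓ y ys} → sorted (y ∷ ys) → ℓ ∈ y ∷ ys → ∣ y ∣ ℕ.≤ ∣ ℓ ∣
  go _ (here refl) = ≤-refl
  go (y≤ ∷ srt) (there ℓ∈) = ≤-trans y≤ (go srt ℓ∈)

WfMember-<head⇒≢ : ∀ {ℓ x y ys} → WfMember ℓ (y ∷ ys) → ∣ x ∣ ℕ.< ∣ y ∣ → x ≢ ℓ
WfMember-<head⇒≢ mem x<y refl = <-irrefl refl (<-≤-trans x<y (WfMember-head≤ mem))

WfMember-neghead⇒≢ : ∀ {ℓ x y ys} → WfMember ℓ (y ∷ ys) → y ≡ - x → x ≢ ℓ
WfMember-neghead⇒≢ ((ncp , _) , ℓ∈) refl refl = ncp _ ℓ∈ (here refl)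

∉-∷⇒≢ : ∀ {ℓ x : ℤ} {xs} → ℓ ∉ x ∷ xs → x ≢ ℓ
∉-∷⇒≢ ℓ∉ refl = ℓ∉ (here refl)

-- Splitting on a test of the merges with this eliminator rather than with a with-function
-- keeps the unchanged clause arguments visible to the termination checker.
if-Dec : ∀ {a p q} {A : Set a} {Q : Set q} (P : A → Set p) (q? : Dec Q) {t e : A} →
         (Q → P t) → (¬ Q → P e) → P (if ⌊ q? ⌋ then t else e)
if-Dec P (yes q) onYes _ = onYes q
if-Dec P (no ¬q) _ onNo = onNo ¬q

≮∧≯⇒≡ : ∀ {m n} → ¬ m ℕ.< n → ¬ n ℕ.< m → m ≡ n
≮∧≯⇒≡ m≮n n≮m = ≤∧≮⇒≡ (≮⇒≥ n≮m) m≮n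

auxunion-∉ : ∀ {ℓ} xs ys acc → ℓ ∉ xs → ℓ ∉ ys → count ℓ (auxunion xs ys acc) ≡ count ℓ acc
auxunion-∉ [] ys acc _ ℓ∉ys = count-reverse-++-∉ acc ys ℓ∉ys
auxunion-∉ (x ∷ xs) [] acc ℓ∉xs _ = count-reverse-++-∉ acc (x ∷ xs) ℓ∉xs
auxunion-∉ {ℓ} (x ∷ xs) (y ∷ ys) acc ℓ∉xs ℓ∉ys =
  if-Dec Goal (∣ x ∣ <? ∣ y ∣)
    (λ _ → trans (auxunion-∉ xs (y ∷ ys) (x ∷ acc) (ℓ∉xs ∘ there) ℓ∉ys) (count-∷-≢ acc x≢ℓ)) λ _ →
  if-Dec Goal (∣ y ∣ <? ∣ x ∣)
    (λ _ → trans (auxunion-∉ (x ∷ xs) ys (y ∷ acc) ℓ∉xs (ℓ∉ys ∘ there)) (count-∷-≢ acc y≢ℓ)) λ _ →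
  if-Dec Goal (x ≟ y)
    (λ _ → trans (auxunion-∉ xs ys (x ∷ acc) (ℓ∉xs ∘ there) (ℓ∉ys ∘ there)) (count-∷-≢ acc x≢ℓ)) λ _ →
  trans (auxunion-∉ xs ys (x ∷ y ∷ acc) (ℓ∉xs ∘ there) (ℓ∉ys ∘ there))
    (trans (count-∷-≢ (y ∷ acc) x≢ℓ) (count-∷-≢ acc y≢ℓ))
  where
  Goal : List ℤ → Set
  Goal r = count ℓ r ≡ count ℓ acc
  x≢ℓ : x ≢ ℓ
  x≢ℓ = ∉-∷⇒≢ ℓ∉xs
  y≢ℓ : y ≢ ℓ
  y≢ℓ = ∉-∷⇒≢ ℓ∉ys

union-∉ : ∀ {ℓ} xs ys acc → ℓ ∉ xs → ℓ ∉ ys → count ℓ (union xs ys acc) ≡ count ℓ acc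
union-∉ [] ys acc _ ℓ∉ys = count-reverse-++-∉ acc ys ℓ∉ys
union-∉ (x ∷ xs) [] acc ℓ∉xs _ = count-reverse-++-∉ acc (x ∷ xs) ℓ∉xs
union-∉ {ℓ} (x ∷ xs) (y ∷ ys) acc ℓ∉xs ℓ∉ys =
  if-Dec Goal (x + y ≟ 0ℤ)
    (λ _ → auxunion-∉ xs ys acc (ℓ∉xs ∘ there) (ℓ∉ys ∘ there)) λ _ →
  if-Dec Goal (∣ x ∣ <? ∣ y ∣)
    (λ _ → trans (union-∉ xs (y ∷ ys) (x ∷ acc) (ℓ∉xs ∘ there) ℓ∉ys) (count-∷-≢ acc x≢ℓ)) λ _ →
  if-Dec Goal (∣ y ∣ <? ∣ x ∣)
    (λ _ → trans (union-∉ (x ∷ xs) ys (y ∷ acc) ℓ∉xs (ℓ∉ys ∘ there)) (count-∷-≢ acc y≢ℓ)) λ _ →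
  trans (union-∉ xs ys (x ∷ acc) (ℓ∉xs ∘ there) (ℓ∉ys ∘ there)) (count-∷-≢ acc x≢ℓ)
  where
  Goal : List ℤ → Set
  Goal r = count ℓ r ≡ count ℓ acc
  x≢ℓ : x ≢ ℓ
  x≢ℓ = ∉-∷⇒≢ ℓ∉xs
  y≢ℓ : y ≢ ℓ
  y≢ℓ = ∉-∷⇒≢ ℓ∉ys

merge-equal-heads : ∀ {ℓ x y xs ys acc} (merge : List ℤ → List ℤ → List ℤ → List ℤ) →
  (∀ acc → ℓ ∉ xs → ℓ ∉ ys → count ℓ (merge xs ys acc) ≡ count ℓ acc) →
  (x ≢ ℓ → count ℓ (merge xs ys (x ∷ acc)) ≡ suc (count ℓ (x ∷ acc))) →
  x ≡ y → WfMember ℓ (x ∷ xs) → WfMember ℓ (y ∷ ys) →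
  count ℓ (merge xs ys (x ∷ acc)) ≡ suc (count ℓ acc)
merge-equal-heads {acc = acc} _ merge-∉ _ refl p@(_ , here refl) q =
  trans (merge-∉ (_ ∷ acc) (WfMember-head∉tail p) (WfMember-head∉tail q)) (count-∷-≡ _ acc)
merge-equal-heads {ℓ} {x} {acc = acc} _ _ merge-∈ refl p@(_ , there ℓ∈xs) _ =
  trans (merge-∈ x≢ℓ) (cong suc (count-∷-≢ acc x≢ℓ))
  where
  x≢ℓ : x ≢ ℓ
  x≢ℓ refl = WfMember-head∉tail p ℓ∈xs

auxunion-∈ : ∀ {ℓ} xs ys acc → WfMember ℓ xs → WfMember ℓ ys →
             count ℓ (auxunion xs ys acc) ≡ suc (count ℓ acc)
auxunion-∈ {ℓ} (x ∷ xs) (y ∷ ys) acc p q =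
  if-Dec Goal (∣ x ∣ <? ∣ y ∣)
    (λ x<y → let x≢ℓ = WfMember-<head⇒≢ q x<y in
      trans (auxunion-∈ xs (y ∷ ys) (x ∷ acc) (WfMember-tail x≢ℓ p) q) (cong suc (count-∷-≢ acc x≢ℓ))) λ x≮y →
  if-Dec Goal (∣ y ∣ <? ∣ x ∣)
    (λ y<x → let y≢ℓ = WfMember-<head⇒≢ p y<x in
      trans (auxunion-∈ (x ∷ xs) ys (y ∷ acc) p (WfMember-tail y≢ℓ q)) (cong suc (count-∷-≢ acc y≢ℓ))) λ y≮x →
  if-Dec Goal (x ≟ y)
    (λ x≡y → merge-equal-heads auxunion (auxunion-∉ xs ys)
      (λ x≢ℓ → auxunion-∈ xs ys (x ∷ acc) (WfMember-tail x≢ℓ p) (WfMember-tail (x≢ℓ ∘ trans x≡y) q)) x≡y p q) λ x≢y →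
  let y≡-x = ∣i∣≡∣j∣∧i≢j⇒j≡-i x y (≮∧≯⇒≡ x≮y y≮x) x≢y
      x≢ℓ = WfMember-neghead⇒≢ q y≡-x
      y≢ℓ = WfMember-neghead⇒≢ p (i≡-j⇒j≡-i y≡-x)
  in trans (auxunion-∈ xs ys (x ∷ y ∷ acc) (WfMember-tail x≢ℓ p) (WfMember-tail y≢ℓ q))
       (cong suc (trans (count-∷-≢ (y ∷ acc) x≢ℓ) (count-∷-≢ acc y≢ℓ)))
  where
  Goal : List ℤ → Set
  Goal r = count ℓ r ≡ suc (count ℓ acc)

union-∈ : ∀ {ℓ} xs ys acc → WfMember ℓ xs → WfMember ℓ ys →
          count ℓ (union xs ys acc) ≡ suc (count ℓ acc)
union-∈ {ℓ} (x ∷ xs) (y ∷ ys) acc p q =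
  if-Dec Goal (x + y ≟ 0ℤ)
    (λ x+y≡0 → let y≡-x = i+j≡0⇒j≡-i x y x+y≡0
                   x≢ℓ = WfMember-neghead⇒≢ q y≡-x
                   y≢ℓ = WfMember-neghead⇒≢ p (i≡-j⇒j≡-i y≡-x)
      in auxunion-∈ xs ys acc (WfMember-tail x≢ℓ p) (WfMember-tail y≢ℓ q)) λ x+y≢0 →
  if-Dec Goal (∣ x ∣ <? ∣ y ∣)
    (λ x<y → let x≢ℓ = WfMember-<head⇒≢ q x<y in
      trans (union-∈ xs (y ∷ ys) (x ∷ acc) (WfMember-tail x≢ℓ p) q) (cong suc (count-∷-≢ acc x≢ℓ))) λ x≮y →
  if-Dec Goal (∣ y ∣ <? ∣ x ∣)
    (λ y<x → let y≢ℓ = WfMember-<head⇒≢ p y<x in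
      trans (union-∈ (x ∷ xs) ys (y ∷ acc) p (WfMember-tail y≢ℓ q)) (cong suc (count-∷-≢ acc y≢ℓ))) λ y≮x →
  let x≡y = ∣i∣≡∣j∣∧i+j≢0⇒i≡j x y (≮∧≯⇒≡ x≮y y≮x) x+y≢0
  in merge-equal-heads union (union-∉ xs ys)
       (λ x≢ℓ → union-∈ xs ys (x ∷ acc) (WfMember-tail x≢ℓ p) (WfMember-tail (x≢ℓ ∘ trans x≡y) q)) x≡y p q
  where
  Goal : List ℤ → Set
  Goal r = count ℓ r ≡ suc (count ℓ acc)

theorem4 : (c₁ c₂ : List ℤ) → Wf c₁ → Wf c₂ → (ℓ₁ ℓ₂ : ℤ) →
    ℓ₁ ∈ c₁ → ℓ₂ ∈ c₂ → ℓ₁ ≡ ℓ₂ →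
    (ℓ₁ ∈ (c₁ ⋈ c₂)) × (count ℓ₁ (c₁ ⋈ c₂) ≡ 1)
theorem4 c₁ c₂ wf₁ wf₂ ℓ .ℓ ℓ∈c₁ ℓ∈c₂ refl = count≡suc⇒∈ (c₁ ⋈ c₂) once , once
  where
  once : count ℓ (c₁ ⋈ c₂) ≡ 1
  once = union-∈ c₁ c₂ [] (wf₁ , ℓ∈c₁) (wf₂ , ℓ∈c₂)
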